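{- For every integer $n\ge 1$, $$\sum_{k=0}^n\frac{\binom{n}{k}\binom{n+k}{k}\binom{2k}{k}}{(-4)^k(k+1)^3}=-\frac{2}{n(n+1)}+\frac{\binom{2\lfloor n/2\rfloor}{\lfloor n/2\rfloor}^2}{16^{\lfloor n/2\rfloor}}\cdot\begin{cases} \dfrac{(2n+1)^2}{n(n+1)} & \text{if $n$ is even},\\[2mm] \dfrac{4n^4+8n^3+3n^2-n+1}{n(n+1)^3} & \text{if $n$ is odd}.\end{cases}$$ -}

module Defs where

open import Data.Nat as ℕ using (ℕ; zero; suc; _^_; NonZero; _%_; _/_)
open import Data.Nat.Combinatorics using (_C_)
open import Data.Integer as ℤ using (ℤ; +_)
open import Data.Rational as ℚ using (ℚ; 0ℚ)
open import Data.List using (List; map; foldr; upTo)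
open import Data.Nat.Properties using (m^n≢0; m*n≢0)

sumℚ : List ℚ → ℚ
sumℚ = foldr ℚ._+_ 0ℚ

summand : ℕ → ℕ → ℚ
summand n k =
  ((ℤ.- + 1) ℤ.^ k ℤ.* + ((n C k) ℕ.* ((n ℕ.+ k) C k) ℕ.* ((2 ℕ.* k) C k)))
    ℚ./ (4 ^ k ℕ.* (suc k ^ 3))
  where instance
    nz : NonZero (4 ^ k ℕ.* (suc k ^ 3))
    nz = m*n≢0 (4 ^ k) (suc k ^ 3) {{m^n≢0 4 k}} {{m^n≢0 (suc k) 3}}

lhs : ℕ → ℚ
lhs n = sumℚ (map (summand n) (upTo (suc n)))

centralFactor : ℕ → ℚ
centralFactor n = + (((2 ℕ.* m) C m) ^ 2) ℚ./ (16 ^ m)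
  where
  m : ℕ
  m = n / 2
  instance
    nz : NonZero (16 ^ m)
    nz = m^n≢0 16 m

caseFactor : (n : ℕ) → .{{NonZero n}} → ℚ
caseFactor n {{nzn}} with n % 2
... | zero = + ((2 ℕ.* n ℕ.+ 1) ^ 2) ℚ./ (n ℕ.* suc n)
  where instance
    nz : NonZero (n ℕ.* suc n)
    nz = m*n≢0 n (suc n)
... | suc _ =
  (+ 4 ℤ.* (+ n) ℤ.^ 4 ℤ.+ + 8 ℤ.* (+ n) ℤ.^ 3 ℤ.+ + 3 ℤ.* (+ n) ℤ.^ 2 ℤ.- + n ℤ.+ + 1)
    ℚ./ (n ℕ.* (suc n ^ 3))
  where instance
    nz : NonZero (n ℕ.* (suc n ^ 3))
    nz = m*n≢0 n (suc n ^ 3) {{nzn}} {{m^n≢0 (suc n) 3}}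

rhs : (n : ℕ) → .{{NonZero n}} → ℚ
rhs n = (ℤ.- + 2) ℚ./ (n ℕ.* suc n) ℚ.+ centralFactor n ℚ.* caseFactor n
  where instance
    nz : NonZero (n ℕ.* suc n)
    nz = m*n≢0 n (suc n)

{-# OPTIONS --safe #-}
-- Creative telescoping. Write F(n, k) for the summand. With the certificate
--   G(n, k) = -2 (n+1)(n+2)(2n+3) (k+1)³ F(n+2, k) / ((n+k+1)(n+k+2))
-- one has a₀(n) F(n, k) + a₁(n) F(n+1, k) + a₂(n) F(n+2, k) = G(n, k+1) - G(n, k), which is
-- checked through the hypergeometric term ratios of F in n and in k. Summing over k, the
-- boundary term G(n, 0) leaves the inhomogeneous recurrence
--   a₀(n) S(n) + a₁(n) S(n+1) + a₂(n) S(n+2) = 2 (2n+3)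
-- for the left-hand side S(n). The right-hand side satisfies the same recurrence: for each
-- parity of n, the three consecutive values involve only two consecutive central factors
-- C(2m,m)²/16ᵐ, related by (m+1)² C(2m+2,m+1)² = 4 (2m+1)² C(2m,m)². Since
-- a₂(n) = (n+1)(n+3)³ ≠ 0, the recurrence and the values at n = 1, 2 determine everything.
module Submission where

open import Defs
open import Data.Nat using (ℕ; NonZero)
open import Relation.Binary.PropositionalEquality using (_≡_)
open import Data.Nat using (zero; suc)

open import Agda.Builtin.FromNat using (Number; fromNat)
open import Data.Integer as ℤ using (ℤ; +_)
open import Data.Integer.Tactic.RingSolver as ℤ-Solver using ()
import Data.Integer.Properties as ℤ
open import Data.Nat.Combinatorics using (_C_; nCk+nC[k+1]≡[n+1]C[k+1]; k>n⇒nCk≡0)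
import Data.Nat as ℕ
import Data.Nat.Literals as ℕ-Literals
import Data.Nat.Properties as ℕ
open import Data.Rational as ℚ using (ℚ; 0ℚ; 1ℚ; _+_; _*_; _-_; -_)
import Data.Rational.Literals as ℚ-Literals
import Data.Rational.Properties as ℚ
import Data.Rational.Unnormalised as ℚᵘ
import Data.Rational.Unnormalised.Properties as ℚᵘ
open import Level using (0ℓ)
open import Data.Unit.Base using (⊤)
open import Relation.Binary.PropositionalEquality using (refl; sym; trans; cong; cong₂; subst; subst₂; module ≡-Reasoning)
open import Data.Product using (_×_; _,_; proj₁; proj₂; ∃-syntax)
open import Data.Sum using (_⊎_; inj₁; inj₂)
open import Relation.Nullary.Decidable.Core using (dec⇒maybe)
open import Data.List using (map; applyUpTo)
open import Function using (_∘_)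
import Data.Nat.DivMod as DivMod
open import Data.Nat.Divisibility using (n∣m*n)
open import Tactic.RingSolver using (solve-∀)
open import Tactic.RingSolver.Core.AlmostCommutativeRing using (AlmostCommutativeRing; fromCommutativeRing)

instance
  ℕ-number : Number ℕ
  ℕ-number = ℕ-Literals.number
  ℚ-number : Number ℚ
  ℚ-number = ℚ-Literals.number

ℚ-ring : AlmostCommutativeRing 0ℓ 0ℓ
ℚ-ring = fromCommutativeRing ℚ.+-*-commutativeRing (λ x → dec⇒maybe (0ℚ ℚ.≟ x))

-- Equational reasoning modulo hypotheses: to prove a ≡ b from equations lᵢ ≡ rᵢ it
-- suffices to exhibit a - b as a combination Σ cᵢ (lᵢ - rᵢ), a ring identity.
infix  5 _·_
infixl 4 _⊕_

_·_ : ∀ {l r} (c : ℚ) → l ≡ r → c * (l - r) ≡ 0ℚ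
_·_ {l} c refl = c*[l-l]≡0 c l
  where
  c*[l-l]≡0 : ∀ c l → c * (l - l) ≡ 0ℚ
  c*[l-l]≡0 = solve-∀ ℚ-ring

_⊕_ : ∀ {u v} → u ≡ 0ℚ → v ≡ 0ℚ → u + v ≡ 0ℚ
u≡0 ⊕ v≡0 = cong₂ _+_ u≡0 v≡0

linear-combination : ∀ {a b e} → a - b ≡ e → e ≡ 0ℚ → a ≡ b
linear-combination {a} {b} a-b≡e e≡0 = begin
  a            ≡⟨ a≡[a-b]+b a b ⟩
  (a - b) + b  ≡⟨ cong (_+ b) (trans a-b≡e e≡0) ⟩
  0ℚ + b       ≡⟨ ℚ.+-identityˡ b ⟩
  b            ∎
  where
  open ≡-Reasoning
  a≡[a-b]+b : ∀ a b → a ≡ (a - b) + b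
  a≡[a-b]+b = solve-∀ ℚ-ring

fromℤ : ℤ → ℚ
fromℤ i = i ℚ./ 1

fromℕ : ℕ → ℚ
fromℕ n = fromℤ (+ n)

1/ℕ : (d : ℕ) → .{{NonZero d}} → ℚ
1/ℕ d = + 1 ℚ./ d

private
  toℚᵘ-/ : ∀ i d → ℚ.toℚᵘ (i ℚ./ ℕ.suc d) ℚᵘ.≃ ℚᵘ.mkℚᵘ i d
  toℚᵘ-/ i d = ℚ.toℚᵘ-fromℚᵘ (ℚᵘ.mkℚᵘ i d)

  toℚᵘ-fromℤ : ∀ i → ℚ.toℚᵘ (fromℤ i) ℚᵘ.≃ ℚᵘ.mkℚᵘ i 0
  toℚᵘ-fromℤ i = toℚᵘ-/ i 0

fromℤ-+ : ∀ i j → fromℤ (i ℤ.+ j) ≡ fromℤ i + fromℤ j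
fromℤ-+ i j = ℚ.toℚᵘ-injective (ℚᵘ.≃-trans (toℚᵘ-fromℤ (i ℤ.+ j)) (ℚᵘ.≃-sym (begin
  ℚ.toℚᵘ (fromℤ i + fromℤ j)                          ≈⟨ ℚ.toℚᵘ-homo-+ (fromℤ i) (fromℤ j) ⟩
  ℚ.toℚᵘ (fromℤ i) ℚᵘ.+ ℚ.toℚᵘ (fromℤ j)             ≈⟨ ℚᵘ.+-cong (toℚᵘ-fromℤ i) (toℚᵘ-fromℤ j) ⟩
  ℚᵘ.mkℚᵘ i 0 ℚᵘ.+ ℚᵘ.mkℚᵘ j 0                        ≈⟨ ℚᵘ.*≡* (over-1 i j) ⟩
  ℚᵘ.mkℚᵘ (i ℤ.+ j) 0                                 ∎)))
  where
  open ℚᵘ.≃-Reasoning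
  over-1 : ∀ i j → (i ℤ.* + 1 ℤ.+ j ℤ.* + 1) ℤ.* + 1 ≡ (i ℤ.+ j) ℤ.* + 1
  over-1 = ℤ-Solver.solve-∀

fromℤ-* : ∀ i j → fromℤ (i ℤ.* j) ≡ fromℤ i * fromℤ j
fromℤ-* i j = ℚ.toℚᵘ-injective (ℚᵘ.≃-trans (toℚᵘ-fromℤ (i ℤ.* j)) (ℚᵘ.≃-sym
  (ℚᵘ.≃-trans (ℚ.toℚᵘ-homo-* (fromℤ i) (fromℤ j)) (ℚᵘ.*-cong (toℚᵘ-fromℤ i) (toℚᵘ-fromℤ j)))))

fromℤ-neg : ∀ i → fromℤ (ℤ.- i) ≡ - fromℤ i
fromℤ-neg i = ℚ.toℚᵘ-injective (ℚᵘ.≃-trans (toℚᵘ-fromℤ (ℤ.- i)) (ℚᵘ.≃-sym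
  (ℚᵘ.≃-trans (ℚ.toℚᵘ-homo‿- (fromℤ i)) (ℚᵘ.-‿cong (toℚᵘ-fromℤ i)))))

fromℕ-+ : ∀ m n → fromℕ (m ℕ.+ n) ≡ fromℕ m + fromℕ n
fromℕ-+ m n = trans (cong fromℤ (ℤ.pos-+ m n)) (fromℤ-+ (+ m) (+ n))

fromℕ-* : ∀ m n → fromℕ (m ℕ.* n) ≡ fromℕ m * fromℕ n
fromℕ-* m n = trans (cong fromℤ (ℤ.pos-* m n)) (fromℤ-* (+ m) (+ n))

fromℕ-suc : ∀ n → fromℕ (suc n) ≡ fromℕ n + 1ℚ
fromℕ-suc n = trans (cong fromℕ (ℕ.+-comm 1 n)) (fromℕ-+ n 1)

i/n*n≡i : ∀ i n .{{_ : NonZero n}} → (i ℚ./ n) * fromℕ n ≡ fromℤ i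
i/n*n≡i i (suc n) = ℚ.toℚᵘ-injective (begin
  ℚ.toℚᵘ ((i ℚ./ suc n) * fromℕ (suc n))                  ≈⟨ ℚ.toℚᵘ-homo-* (i ℚ./ suc n) (fromℕ (suc n)) ⟩
  ℚ.toℚᵘ (i ℚ./ suc n) ℚᵘ.* ℚ.toℚᵘ (fromℕ (suc n))        ≈⟨ ℚᵘ.*-cong (toℚᵘ-/ i n) (toℚᵘ-fromℤ (+ suc n)) ⟩
  ℚᵘ.mkℚᵘ i n ℚᵘ.* ℚᵘ.mkℚᵘ (+ suc n) 0                    ≈⟨ ℚᵘ.*≡* (cross-multiplied i n) ⟩
  ℚᵘ.mkℚᵘ i 0                                              ≈⟨ toℚᵘ-fromℤ i ⟨
  ℚ.toℚᵘ (fromℤ i)                                         ∎)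
  where
  open ℚᵘ.≃-Reasoning
  cross-multiplied : ∀ i n → (i ℤ.* + suc n) ℤ.* + 1 ≡ i ℤ.* + suc (n ℕ.* 1)
  cross-multiplied i n rewrite ℕ.*-identityʳ n = ℤ.*-identityʳ (i ℤ.* + suc n)

n*1/n≡1 : ∀ n .{{_ : NonZero n}} → fromℕ n * 1/ℕ n ≡ 1ℚ
n*1/n≡1 n = trans (ℚ.*-comm (fromℕ n) (1/ℕ n)) (i/n*n≡i (+ 1) n)

*-cancelˡ-fromℕ : ∀ n .{{_ : NonZero n}} {e a b} → fromℕ n ≡ e → e * a ≡ e * b → a ≡ b
*-cancelˡ-fromℕ n {a = a} {b} refl na≡nb =
  linear-combination (by-inverse (fromℕ n) (1/ℕ n) a b) (1/ℕ n · na≡nb ⊕ b - a · n*1/n≡1 n)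
  where
  by-inverse : ∀ n n⁻¹ a b → a - b ≡ n⁻¹ * (n * a - n * b) + (b - a) * (n * n⁻¹ - 1ℚ)
  by-inverse = solve-∀ ℚ-ring

i/n≡i*1/n : ∀ i n .{{_ : NonZero n}} → i ℚ./ n ≡ fromℤ i * 1/ℕ n
i/n≡i*1/n i n = *-cancelˡ-fromℕ n refl (begin
  fromℕ n * (i ℚ./ n)               ≡⟨ ℚ.*-comm (fromℕ n) (i ℚ./ n) ⟩
  (i ℚ./ n) * fromℕ n               ≡⟨ i/n*n≡i i n ⟩
  fromℤ i                           ≡⟨ ℚ.*-identityʳ (fromℤ i) ⟨
  fromℤ i * 1ℚ                      ≡⟨ cong (fromℤ i *_) (n*1/n≡1 n) ⟨
  fromℤ i * (fromℕ n * 1/ℕ n)       ≡⟨ x*[y*z]≡y*[x*z] (fromℤ i) (fromℕ n) (1/ℕ n) ⟩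
  fromℕ n * (fromℤ i * 1/ℕ n)       ∎)
  where
  open ≡-Reasoning
  x*[y*z]≡y*[x*z] : ∀ x y z → x * (y * z) ≡ y * (x * z)
  x*[y*z]≡y*[x*z] = solve-∀ ℚ-ring

1/ℕ-* : ∀ m n .{{_ : NonZero m}} .{{_ : NonZero n}} → 1/ℕ (m ℕ.* n) {{ℕ.m*n≢0 m n}} ≡ 1/ℕ m * 1/ℕ n
1/ℕ-* m n = *-cancelˡ-fromℕ (m ℕ.* n) {{ℕ.m*n≢0 m n}} refl (linear-combination
  (inverses (fromℕ (m ℕ.* n)) (fromℕ m) (fromℕ n) (1/ℕ (m ℕ.* n) {{ℕ.m*n≢0 m n}}) (1/ℕ m) (1/ℕ n))
  (1ℚ · n*1/n≡1 (m ℕ.* n) {{ℕ.m*n≢0 m n}} ⊕ - (1/ℕ m * 1/ℕ n) · fromℕ-* m n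
     ⊕ - (fromℕ n * 1/ℕ n) · n*1/n≡1 m ⊕ - 1ℚ · n*1/n≡1 n))
  where
  inverses : ∀ mn m n mn⁻¹ m⁻¹ n⁻¹ → mn * mn⁻¹ - mn * (m⁻¹ * n⁻¹)
    ≡ 1ℚ * (mn * mn⁻¹ - 1ℚ) + - (m⁻¹ * n⁻¹) * (mn - m * n)
      + - (n * n⁻¹) * (m * m⁻¹ - 1ℚ) + - 1ℚ * (n * n⁻¹ - 1ℚ)
  inverses = solve-∀ ℚ-ring

fromℕ-² : ∀ n → fromℕ (n ℕ.^ 2) ≡ fromℕ n * fromℕ n
fromℕ-² n = trans (fromℕ-* n (n ℕ.* 1)) (cong (fromℕ n *_) (trans (fromℕ-* n 1) (ℚ.*-identityʳ (fromℕ n))))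

1/ℕ-inverse : ∀ n .{{_ : NonZero n}} {e} → fromℕ n ≡ e → 1/ℕ n * e ≡ 1ℚ
1/ℕ-inverse n refl = trans (ℚ.*-comm (1/ℕ n) (fromℕ n)) (n*1/n≡1 n)

fromℕ-[1+n]³ : ∀ n → fromℕ (suc n ℕ.^ 3) ≡ (fromℕ n + 1ℚ) * (fromℕ n + 1ℚ) * (fromℕ n + 1ℚ)
fromℕ-[1+n]³ n = begin
  fromℕ (suc n ℕ.* (suc n ℕ.* (suc n ℕ.* 1)))  ≡⟨ fromℕ-* (suc n) (suc n ℕ.* (suc n ℕ.* 1)) ⟩
  y′ * fromℕ (suc n ℕ.* (suc n ℕ.* 1))         ≡⟨ cong (y′ *_) (fromℕ-* (suc n) (suc n ℕ.* 1)) ⟩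
  y′ * (y′ * fromℕ (suc n ℕ.* 1))              ≡⟨ cong (λ z → y′ * (y′ * z)) (fromℕ-* (suc n) 1) ⟩
  y′ * (y′ * (y′ * 1ℚ))                        ≡⟨ cong (λ z → z * (z * (z * 1ℚ))) (fromℕ-suc n) ⟩
  (y + 1ℚ) * ((y + 1ℚ) * ((y + 1ℚ) * 1ℚ))      ≡⟨ reassociate y ⟩
  (y + 1ℚ) * (y + 1ℚ) * (y + 1ℚ)               ∎
  where
  open ≡-Reasoning
  y = fromℕ n
  y′ = fromℕ (suc n)
  reassociate : ∀ y → (y + 1ℚ) * ((y + 1ℚ) * ((y + 1ℚ) * 1ℚ)) ≡ (y + 1ℚ) * (y + 1ℚ) * (y + 1ℚ)
  reassociate = solve-∀ ℚ-ring

Cℚ : ℕ → ℕ → ℚ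
Cℚ n k = fromℕ (n C k)

Cℚ-pascal : ∀ n k → Cℚ n k + Cℚ n (suc k) ≡ Cℚ (suc n) (suc k)
Cℚ-pascal n k = trans (sym (fromℕ-+ (n C k) (n C suc k))) (cong fromℕ (nCk+nC[k+1]≡[n+1]C[k+1] n k))

Cℚ-absorption : ∀ n k → (fromℕ k + 1ℚ) * Cℚ (suc n) (suc k) ≡ (fromℕ n + 1ℚ) * Cℚ n k
Cℚ-absorption zero    zero    = refl
Cℚ-absorption zero    (suc k) = trans (ℚ.*-zeroʳ (fromℕ (suc k) + 1ℚ)) (sym (ℚ.*-zeroʳ (0ℚ + 1ℚ)))
Cℚ-absorption (suc n) zero    = linear-combination (identity (fromℕ n) (fromℕ (suc n)) (Cℚ (suc n) 1) (Cℚ (2 ℕ.+ n) 1))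
  (- 1ℚ · Cℚ-pascal (suc n) 0 ⊕ 1ℚ · Cℚ-absorption n 0 ⊕ - 1ℚ · fromℕ-suc n)
  where
  identity : ∀ y y′ b e → (0ℚ + 1ℚ) * e - (y′ + 1ℚ) * 1ℚ
    ≡ - 1ℚ * ((1ℚ + b) - e) + 1ℚ * ((0ℚ + 1ℚ) * b - (y + 1ℚ) * 1ℚ) + - 1ℚ * (y′ - (y + 1ℚ))
  identity = solve-∀ ℚ-ring
Cℚ-absorption (suc n) (suc k) = linear-combination (identity (fromℕ k) (fromℕ (suc k)) (fromℕ n) (fromℕ (suc n)) a b c d e)
  (- (x + 1ℚ + 1ℚ) · Cℚ-pascal (suc n) (suc k) ⊕ 1ℚ · Cℚ-absorption n (suc k) ⊕ 1ℚ · Cℚ-absorption n k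
     ⊕ y + 1ℚ · Cℚ-pascal n k ⊕ e - b · fromℕ-suc k ⊕ - a · fromℕ-suc n)
  where
  x = fromℕ k
  y = fromℕ n
  a = Cℚ (suc n) (suc k)
  b = Cℚ (suc n) (2 ℕ.+ k)
  c = Cℚ n k
  d = Cℚ n (suc k)
  e = Cℚ (2 ℕ.+ n) (2 ℕ.+ k)
  identity : ∀ x x′ y y′ a b c d e → (x′ + 1ℚ) * e - (y′ + 1ℚ) * a
    ≡ - (x + 1ℚ + 1ℚ) * ((a + b) - e) + 1ℚ * ((x′ + 1ℚ) * b - (y + 1ℚ) * d) + 1ℚ * ((x + 1ℚ) * a - (y + 1ℚ) * c)
      + (y + 1ℚ) * ((c + d) - a) + (e - b) * (x′ - (x + 1ℚ)) + - a * (y′ - (y + 1ℚ))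
  identity = solve-∀ ℚ-ring

Cℚ-upper-step : ∀ m k → (fromℕ m + 1ℚ) * Cℚ (suc m) k ≡ (fromℕ m + 1ℚ) * Cℚ m k + fromℕ k * Cℚ (suc m) k
Cℚ-upper-step m zero    = identity (fromℕ m)
  where
  identity : ∀ y → (y + 1ℚ) * 1ℚ ≡ (y + 1ℚ) * 1ℚ + 0ℚ * 1ℚ
  identity = solve-∀ ℚ-ring
Cℚ-upper-step m (suc j) = linear-combination
  (identity (fromℕ j) (fromℕ m) (fromℕ (suc j)) (Cℚ (suc m) (suc j)) (Cℚ m (suc j)) (Cℚ m j))
  (- 1ℚ · Cℚ-absorption m j ⊕ - (fromℕ m + 1ℚ) · Cℚ-pascal m j ⊕ - Cℚ (suc m) (suc j) · fromℕ-suc j)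
  where
  identity : ∀ x y x′ e d c → (y + 1ℚ) * e - ((y + 1ℚ) * d + x′ * e)
    ≡ - 1ℚ * ((x + 1ℚ) * e - (y + 1ℚ) * c) + - (y + 1ℚ) * ((c + d) - e) + - e * (x′ - (x + 1ℚ))
  identity = solve-∀ ℚ-ring

Cℚ-lower-step : ∀ m k → (fromℕ k + 1ℚ) * Cℚ m (suc k) + fromℕ k * Cℚ m k ≡ fromℕ m * Cℚ m k
Cℚ-lower-step zero    zero    = refl
Cℚ-lower-step zero    (suc k) = identity (fromℕ (suc k))
  where
  identity : ∀ x → (x + 1ℚ) * 0ℚ + x * 0ℚ ≡ 0ℚ * 0ℚ
  identity = solve-∀ ℚ-ring
Cℚ-lower-step (suc m) k = linear-combination
  (identity (fromℕ k) (fromℕ m) (fromℕ (suc m)) (Cℚ (suc m) (suc k)) (Cℚ (suc m) k) (Cℚ m k))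
  (1ℚ · Cℚ-absorption m k ⊕ - 1ℚ · Cℚ-upper-step m k ⊕ - Cℚ (suc m) k · fromℕ-suc m)
  where
  identity : ∀ x y y′ e f g → (x + 1ℚ) * e + x * f - y′ * f
    ≡ 1ℚ * ((x + 1ℚ) * e - (y + 1ℚ) * g) + - 1ℚ * ((y + 1ℚ) * f - ((y + 1ℚ) * g + x * f)) + - f * (y′ - (y + 1ℚ))
  identity = solve-∀ ℚ-ring

Cℚ-central-step : ∀ k → (fromℕ k + 1ℚ) * Cℚ (2 ℕ.+ 2 ℕ.* k) (suc k) ≡ 2 * (2 * fromℕ k + 1ℚ) * Cℚ (2 ℕ.* k) k
Cℚ-central-step k = linear-combination
  (identity (fromℕ k) (fromℕ (suc (2 ℕ.* k))) (fromℕ (2 ℕ.* k)) (Cℚ (2 ℕ.+ 2 ℕ.* k) (suc k)) c₁ d)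
  (1ℚ · Cℚ-absorption (suc (2 ℕ.* k)) k ⊕ c₁ · fromℕ-suc (2 ℕ.* k)
     ⊕ c₁ - 2 * (c₁ - d) · fromℕ-* 2 k ⊕ 2 · Cℚ-upper-step (2 ℕ.* k) k)
  where
  c₁ = Cℚ (suc (2 ℕ.* k)) k
  d = Cℚ (2 ℕ.* k) k
  identity : ∀ x s w c c₁ d → (x + 1ℚ) * c - 2 * (2 * x + 1ℚ) * d
    ≡ 1ℚ * ((x + 1ℚ) * c - (s + 1ℚ) * c₁) + c₁ * (s - (w + 1ℚ)) + (c₁ - 2 * (c₁ - d)) * (w - 2 * x)
      + 2 * ((w + 1ℚ) * c₁ - ((w + 1ℚ) * d + x * c₁))
  identity = solve-∀ ℚ-ring

numerator : ℕ → ℕ → ℚ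
numerator n k = Cℚ n k * Cℚ (n ℕ.+ k) k * Cℚ (2 ℕ.* k) k

[-1/4]^ : ℕ → ℚ
[-1/4]^ k = fromℤ ((ℤ.- + 1) ℤ.^ k) * 1/ℕ (4 ℕ.^ k) {{ℕ.m^n≢0 4 k}}

1/[1+_]³ : ℕ → ℚ
1/[1+ k ]³ = 1/ℕ (suc k ℕ.^ 3) {{ℕ.m^n≢0 (suc k) 3}}

1/[1+k]³-inverse : ∀ k → 1/[1+ k ]³ * ((fromℕ k + 1ℚ) * (fromℕ k + 1ℚ) * (fromℕ k + 1ℚ)) ≡ 1ℚ
1/[1+k]³-inverse k = 1/ℕ-inverse (suc k ℕ.^ 3) {{ℕ.m^n≢0 (suc k) 3}} (fromℕ-[1+n]³ k)

[-1/4]^-suc : ∀ k → [-1/4]^ (suc k) ≡ - ([-1/4]^ k * 1/ℕ 4)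
[-1/4]^-suc k = begin
  fromℤ (ℤ.- + 1 ℤ.* s) * 1/ℕ (4 ℕ.* 4 ℕ.^ k) {{ℕ.m^n≢0 4 (suc k)}}
    ≡⟨ cong₂ _*_ (fromℤ-* (ℤ.- + 1) s) (1/ℕ-* 4 (4 ℕ.^ k) {{_}} {{ℕ.m^n≢0 4 k}}) ⟩
  (fromℤ (ℤ.- + 1) * fromℤ s) * (1/ℕ 4 * 1/ℕ (4 ℕ.^ k) {{ℕ.m^n≢0 4 k}})
    ≡⟨ rearrange (fromℤ s) (1/ℕ 4) (1/ℕ (4 ℕ.^ k) {{ℕ.m^n≢0 4 k}}) ⟩
  - ([-1/4]^ k * 1/ℕ 4) ∎
  where
  open ≡-Reasoning
  s = (ℤ.- + 1) ℤ.^ k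
  rearrange : ∀ a b c → (fromℤ (ℤ.- + 1) * a) * (b * c) ≡ - ((a * c) * b)
  rearrange = solve-∀ ℚ-ring

summand-factorised : ∀ n k → summand n k ≡ [-1/4]^ k * numerator n k * 1/[1+ k ]³
summand-factorised n k = begin
  summand n k
    ≡⟨ i/n≡i*1/n (s ℤ.* + N) (4 ℕ.^ k ℕ.* suc k ℕ.^ 3) {{4ᵏ[1+k]³≢0}} ⟩
  fromℤ (s ℤ.* + N) * 1/ℕ (4 ℕ.^ k ℕ.* suc k ℕ.^ 3) {{4ᵏ[1+k]³≢0}}
    ≡⟨ cong₂ _*_ (fromℤ-* s (+ N)) (1/ℕ-* (4 ℕ.^ k) (suc k ℕ.^ 3) {{ℕ.m^n≢0 4 k}} {{ℕ.m^n≢0 (suc k) 3}}) ⟩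
  (fromℤ s * fromℕ N) * (1/ℕ (4 ℕ.^ k) {{ℕ.m^n≢0 4 k}} * 1/[1+ k ]³)
    ≡⟨ cong (λ z → (fromℤ s * z) * (1/ℕ (4 ℕ.^ k) {{ℕ.m^n≢0 4 k}} * 1/[1+ k ]³)) fromℕ-N ⟩
  (fromℤ s * numerator n k) * (1/ℕ (4 ℕ.^ k) {{ℕ.m^n≢0 4 k}} * 1/[1+ k ]³)
    ≡⟨ rearrange (fromℤ s) (numerator n k) (1/ℕ (4 ℕ.^ k) {{ℕ.m^n≢0 4 k}}) 1/[1+ k ]³ ⟩
  [-1/4]^ k * numerator n k * 1/[1+ k ]³ ∎
  where
  open ≡-Reasoning
  s = (ℤ.- + 1) ℤ.^ k
  N = (n C k) ℕ.* ((n ℕ.+ k) C k) ℕ.* ((2 ℕ.* k) C k)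
  4ᵏ[1+k]³≢0 = ℕ.m*n≢0 (4 ℕ.^ k) (suc k ℕ.^ 3) {{ℕ.m^n≢0 4 k}} {{ℕ.m^n≢0 (suc k) 3}}
  fromℕ-N : fromℕ N ≡ numerator n k
  fromℕ-N = trans (fromℕ-* ((n C k) ℕ.* ((n ℕ.+ k) C k)) ((2 ℕ.* k) C k))
                  (cong (_* Cℚ (2 ℕ.* k) k) (fromℕ-* (n C k) ((n ℕ.+ k) C k)))
  rearrange : ∀ a b c d → (a * b) * (c * d) ≡ a * c * b * d
  rearrange = solve-∀ ℚ-ring

numerator-ratio-n : ∀ m k → (fromℕ m + 1ℚ - fromℕ k) * numerator (suc m) k ≡ (fromℕ m + 1ℚ + fromℕ k) * numerator m k
numerator-ratio-n m k = linear-combination (identity x y z a₁ a₀ e₁ e₀ d)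
  (d * e₁ · Cℚ-upper-step m k ⊕ d * a₀ · Cℚ-upper-step (m ℕ.+ k) k ⊕ - (d * a₀ * (e₁ - e₀)) · fromℕ-+ m k)
  where
  x = fromℕ k
  y = fromℕ m
  z = fromℕ (m ℕ.+ k)
  a₁ = Cℚ (suc m) k
  a₀ = Cℚ m k
  e₁ = Cℚ (suc (m ℕ.+ k)) k
  e₀ = Cℚ (m ℕ.+ k) k
  d = Cℚ (2 ℕ.* k) k
  identity : ∀ x y z a₁ a₀ e₁ e₀ d → (y + 1ℚ - x) * (a₁ * e₁ * d) - (y + 1ℚ + x) * (a₀ * e₀ * d)
    ≡ (d * e₁) * ((y + 1ℚ) * a₁ - ((y + 1ℚ) * a₀ + x * a₁)) + (d * a₀) * ((z + 1ℚ) * e₁ - ((z + 1ℚ) * e₀ + x * e₁))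
      + - (d * a₀ * (e₁ - e₀)) * (z - (y + x))
  identity = solve-∀ ℚ-ring

numerator-suc-k : ∀ m k → numerator m (suc k) ≡ Cℚ m (suc k) * Cℚ (suc (m ℕ.+ k)) (suc k) * Cℚ (2 ℕ.+ 2 ℕ.* k) (suc k)
numerator-suc-k m k = cong₂ (λ a b → Cℚ m (suc k) * Cℚ a (suc k) * Cℚ b (suc k)) (ℕ.+-suc m k) (ℕ.*-suc 2 k)

numerator-ratio-k : ∀ m k → (fromℕ k + 1ℚ) * (fromℕ k + 1ℚ) * (fromℕ k + 1ℚ) * numerator m (suc k)
  ≡ 2 * (fromℕ m - fromℕ k) * (fromℕ m + fromℕ k + 1ℚ) * (2 * fromℕ k + 1ℚ) * numerator m k
numerator-ratio-k m k = linear-combination (identity x y z a a₀ b b₀ c d (numerator m (suc k)))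
  ((x + 1ℚ) * (x + 1ℚ) * (x + 1ℚ) · numerator-suc-k m k
     ⊕ (x + 1ℚ) * (x + 1ℚ) * b * c · Cℚ-lower-step m k
     ⊕ (y - x) * a₀ * (x + 1ℚ) * c · Cℚ-absorption (m ℕ.+ k) k
     ⊕ (y - x) * a₀ * (x + 1ℚ) * c * b₀ · fromℕ-+ m k
     ⊕ (y - x) * (y + x + 1ℚ) * a₀ * b₀ · Cℚ-central-step k)
  where
  x = fromℕ k
  y = fromℕ m
  z = fromℕ (m ℕ.+ k)
  a = Cℚ m (suc k)
  a₀ = Cℚ m k
  b = Cℚ (suc (m ℕ.+ k)) (suc k)
  b₀ = Cℚ (m ℕ.+ k) k
  c = Cℚ (2 ℕ.+ 2 ℕ.* k) (suc k)
  d = Cℚ (2 ℕ.* k) k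
  identity : ∀ x y z a a₀ b b₀ c d n →
    (x + 1ℚ) * (x + 1ℚ) * (x + 1ℚ) * n - 2 * (y - x) * (y + x + 1ℚ) * (2 * x + 1ℚ) * (a₀ * b₀ * d)
    ≡ (x + 1ℚ) * (x + 1ℚ) * (x + 1ℚ) * (n - a * b * c)
      + (x + 1ℚ) * (x + 1ℚ) * b * c * ((x + 1ℚ) * a + x * a₀ - y * a₀)
      + (y - x) * a₀ * (x + 1ℚ) * c * ((x + 1ℚ) * b - (z + 1ℚ) * b₀)
      + (y - x) * a₀ * (x + 1ℚ) * c * b₀ * (z - (y + x))
      + (y - x) * (y + x + 1ℚ) * a₀ * b₀ * ((x + 1ℚ) * c - 2 * (2 * x + 1ℚ) * d)
  identity = solve-∀ ℚ-ring

summand-ratio-n : ∀ n k → (fromℕ n + fromℕ k + 1ℚ) * summand n k ≡ (fromℕ n + 1ℚ - fromℕ k) * summand (suc n) k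
summand-ratio-n n k = linear-combination
  (identity (fromℕ n) (fromℕ k) ([-1/4]^ k) 1/[1+ k ]³ (numerator n k) (numerator (suc n) k) (summand n k) (summand (suc n) k))
  (fromℕ n + fromℕ k + 1ℚ · summand-factorised n k ⊕ - (fromℕ n + 1ℚ - fromℕ k) · summand-factorised (suc n) k
     ⊕ - ([-1/4]^ k * 1/[1+ k ]³) · numerator-ratio-n n k)
  where
  identity : ∀ y x s w n₀ n₁ f₀ f₁ → (y + x + 1ℚ) * f₀ - (y + 1ℚ - x) * f₁
    ≡ (y + x + 1ℚ) * (f₀ - s * n₀ * w) + - (y + 1ℚ - x) * (f₁ - s * n₁ * w)
      + - (s * w) * ((y + 1ℚ - x) * n₁ - (y + 1ℚ + x) * n₀)
  identity = solve-∀ ℚ-ring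

summand-ratio-k : ∀ m k → 2 * ((fromℕ k + 2) * (fromℕ k + 2) * (fromℕ k + 2)) * summand m (suc k)
  ≡ - ((fromℕ m + fromℕ k + 1ℚ) * (fromℕ m - fromℕ k) * (2 * fromℕ k + 1ℚ) * summand m k)
summand-ratio-k m k = linear-combination (identity y x x′ s s′ w w′ (numerator m k) n′ (summand m k) f′)
  (2 * ((x + 2) * (x + 2) * (x + 2)) · summand-factorised m (suc k)
     ⊕ 2 * ((x + 2) * (x + 2) * (x + 2)) * n′ * w′ · [-1/4]^-suc k
     ⊕ (y + x + 1ℚ) * (y - x) * (2 * x + 1ℚ) · summand-factorised m k
     ⊕ - (2 * s * 1/ℕ 4 * w) · numerator-ratio-k m k
     ⊕ - (2 * s * 1/ℕ 4 * n′) · 1/[1+k]³-inverse (suc k)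
     ⊕ 2 * s * 1/ℕ 4 * n′ * w′ * ((x′ + 1ℚ) * (x′ + 1ℚ) + (x′ + 1ℚ) * (x + 2) + (x + 2) * (x + 2)) · fromℕ-suc k
     ⊕ 2 * s * 1/ℕ 4 * n′ · 1/[1+k]³-inverse k)
  where
  x = fromℕ k
  x′ = fromℕ (suc k)
  y = fromℕ m
  s = [-1/4]^ k
  s′ = [-1/4]^ (suc k)
  w = 1/[1+ k ]³
  w′ = 1/[1+ suc k ]³
  n′ = numerator m (suc k)
  f′ = summand m (suc k)
  identity : ∀ y x x′ s s′ w w′ n n′ f f′ →
    2 * ((x + 2) * (x + 2) * (x + 2)) * f′ - - ((y + x + 1ℚ) * (y - x) * (2 * x + 1ℚ) * f)
    ≡ 2 * ((x + 2) * (x + 2) * (x + 2)) * (f′ - s′ * n′ * w′)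
      + 2 * ((x + 2) * (x + 2) * (x + 2)) * n′ * w′ * (s′ - - (s * 1/ℕ 4))
      + (y + x + 1ℚ) * (y - x) * (2 * x + 1ℚ) * (f - s * n * w)
      + - (2 * s * 1/ℕ 4 * w) * ((x + 1ℚ) * (x + 1ℚ) * (x + 1ℚ) * n′ - 2 * (y - x) * (y + x + 1ℚ) * (2 * x + 1ℚ) * n)
      + - (2 * s * 1/ℕ 4 * n′) * (w′ * ((x′ + 1ℚ) * (x′ + 1ℚ) * (x′ + 1ℚ)) - 1ℚ)
      + 2 * s * 1/ℕ 4 * n′ * w′ * ((x′ + 1ℚ) * (x′ + 1ℚ) + (x′ + 1ℚ) * (x + 2) + (x + 2) * (x + 2)) * (x′ - (x + 1ℚ))
      + 2 * s * 1/ℕ 4 * n′ * (w * ((x + 1ℚ) * (x + 1ℚ) * (x + 1ℚ)) - 1ℚ)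
  identity = solve-∀ ℚ-ring

-- The recurrence and its certificate as produced by Zeilberger's algorithm for the summand.
a₀ a₁ a₂ b : ℚ → ℚ
a₀ y = - (y * y * y * (y + 2))
a₁ y = - ((2 * y + 3) * (3 * y * y + 9 * y + 5))
a₂ y = (y + 1ℚ) * ((y + 3) * (y + 3) * (y + 3))
b y = 2 * (2 * y + 3)

certificate : ℕ → ℕ → ℚ
certificate n k = - (2 * (y + 1ℚ) * (y + 2) * (2 * y + 3)) * ((x + 1ℚ) * (x + 1ℚ) * (x + 1ℚ))
                  * summand (2 ℕ.+ n) k * 1/ℕ (suc (n ℕ.+ k) ℕ.* suc (suc (n ℕ.+ k)))
  where
  x = fromℕ k
  y = fromℕ n

fromℕ-[1+n+k] : ∀ n k → fromℕ (suc (n ℕ.+ k)) ≡ fromℕ n + fromℕ k + 1ℚ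
fromℕ-[1+n+k] n k = trans (fromℕ-suc (n ℕ.+ k)) (cong (_+ 1ℚ) (fromℕ-+ n k))

certificate-denominator : ∀ n k →
  1/ℕ (suc (n ℕ.+ k) ℕ.* suc (suc (n ℕ.+ k))) * ((fromℕ n + fromℕ k + 1ℚ) * (fromℕ n + fromℕ k + 1ℚ + 1ℚ)) ≡ 1ℚ
certificate-denominator n k = 1/ℕ-inverse (suc (n ℕ.+ k) ℕ.* suc (suc (n ℕ.+ k)))
  (trans (fromℕ-* (suc (n ℕ.+ k)) (suc (suc (n ℕ.+ k))))
         (cong₂ _*_ (fromℕ-[1+n+k] n k) (trans (fromℕ-suc (suc (n ℕ.+ k))) (cong (_+ 1ℚ) (fromℕ-[1+n+k] n k)))))

fromℕ-2[1+n+k][2+n+k][3+n+k] : ∀ n k → fromℕ (2 ℕ.* (suc (n ℕ.+ k) ℕ.* (suc (suc (n ℕ.+ k)) ℕ.* suc (suc (suc (n ℕ.+ k))))))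
  ≡ 2 * ((fromℕ n + fromℕ k + 1ℚ) * ((fromℕ n + fromℕ k + 1ℚ + 1ℚ) * (fromℕ n + fromℕ k + 1ℚ + 1ℚ + 1ℚ)))
fromℕ-2[1+n+k][2+n+k][3+n+k] n k = begin
  fromℕ (2 ℕ.* (p ℕ.* (suc p ℕ.* suc (suc p))))            ≡⟨ fromℕ-* 2 (p ℕ.* (suc p ℕ.* suc (suc p))) ⟩
  2 * fromℕ (p ℕ.* (suc p ℕ.* suc (suc p)))                ≡⟨ cong (2 *_) (fromℕ-* p (suc p ℕ.* suc (suc p))) ⟩
  2 * (fromℕ p * fromℕ (suc p ℕ.* suc (suc p)))            ≡⟨ cong (λ z → 2 * (fromℕ p * z)) (fromℕ-* (suc p) (suc (suc p))) ⟩
  2 * (fromℕ p * (fromℕ (suc p) * fromℕ (suc (suc p))))    ≡⟨ cong (λ z → 2 * (fromℕ p * (fromℕ (suc p) * z))) (fromℕ-suc (suc p)) ⟩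
  2 * (fromℕ p * (fromℕ (suc p) * (fromℕ (suc p) + 1ℚ)))   ≡⟨ cong (λ z → 2 * (fromℕ p * (z * (z + 1ℚ)))) (fromℕ-suc p) ⟩
  2 * (fromℕ p * ((fromℕ p + 1ℚ) * (fromℕ p + 1ℚ + 1ℚ)))   ≡⟨ cong (λ z → 2 * (z * ((z + 1ℚ) * (z + 1ℚ + 1ℚ)))) (fromℕ-[1+n+k] n k) ⟩
  2 * ((fromℕ n + fromℕ k + 1ℚ) * ((fromℕ n + fromℕ k + 1ℚ + 1ℚ) * (fromℕ n + fromℕ k + 1ℚ + 1ℚ + 1ℚ))) ∎
  where
  open ≡-Reasoning
  p = suc (n ℕ.+ k)

-- In the combination below only the first five terms carry content; the last three rewrite
-- fromℕ (1 + n), fromℕ (2 + n) and fromℕ (1 + k) in terms of fromℕ n and fromℕ k.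
summand-recurrence : ∀ n k → let y = fromℕ n in
  a₀ y * summand n k + a₁ y * summand (suc n) k + a₂ y * summand (2 ℕ.+ n) k ≡ certificate n (suc k) - certificate n k
summand-recurrence n k = *-cancelˡ-fromℕ (2 ℕ.* (suc (n ℕ.+ k) ℕ.* (suc (suc (n ℕ.+ k)) ℕ.* suc (suc (suc (n ℕ.+ k))))))
    (fromℕ-2[1+n+k][2+n+k][3+n+k] n k) (linear-combination
  (identity y y₁ y₂ x x′ f₀ f₁ f₂ f₃ u v)
  (2 * Q * R * a₀ y · summand-ratio-n n k
     ⊕ c₂ · summand-ratio-n (suc n) k
     ⊕ - (c * P) · summand-ratio-k (2 ℕ.+ n) k
     ⊕ 2 * c * R * ((x + 1ℚ) * (x + 1ℚ) * (x + 1ℚ)) * f₂ · certificate-denominator n k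
     ⊕ - (2 * c * P * ((x + 2) * (x + 2) * (x + 2)) * f₃) · certificate-denominator n (suc k)
     ⊕ - (c₂ * (f₁ - f₂)) · fromℕ-suc n
     ⊕ c * P * (2 * x + 1ℚ) * f₂ * (y₂ + y + 3) · fromℕ-+ 2 n
     ⊕ 2 * c * P * ((x + 2) * (x + 2) * (x + 2)) * f₃ * v * (y + x′ + 1ℚ + R)
       - 2 * (P * (Q * R)) * c * f₃ * v * ((x′ + 1ℚ) * (x′ + 1ℚ) + (x′ + 1ℚ) * (x + 2) + (x + 2) * (x + 2)) · fromℕ-suc k))
  where
  y = fromℕ n
  y₁ = fromℕ (suc n)
  y₂ = fromℕ (2 ℕ.+ n)
  x = fromℕ k
  x′ = fromℕ (suc k)
  f₀ = summand n k
  f₁ = summand (suc n) k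
  f₂ = summand (2 ℕ.+ n) k
  f₃ = summand (2 ℕ.+ n) (suc k)
  u = 1/ℕ (suc (n ℕ.+ k) ℕ.* suc (suc (n ℕ.+ k)))
  v = 1/ℕ (suc (n ℕ.+ suc k) ℕ.* suc (suc (n ℕ.+ suc k)))
  P = y + x + 1ℚ
  Q = y + x + 1ℚ + 1ℚ
  R = y + x + 1ℚ + 1ℚ + 1ℚ
  c = - (2 * (y + 1ℚ) * (y + 2) * (2 * y + 3))
  c₂ = 2 * R * a₀ y * (y + 1ℚ - x) + 2 * P * R * a₁ y
  identity : ∀ y y₁ y₂ x x′ f₀ f₁ f₂ f₃ u v →
    let P = y + x + 1ℚ
        Q = y + x + 1ℚ + 1ℚ
        R = y + x + 1ℚ + 1ℚ + 1ℚ
        c = - (2 * (y + 1ℚ) * (y + 2) * (2 * y + 3))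
        a₀ = - (y * y * y * (y + 2))
        a₁ = - ((2 * y + 3) * (3 * y * y + 9 * y + 5))
        a₂ = (y + 1ℚ) * ((y + 3) * (y + 3) * (y + 3))
        c₂ = 2 * R * a₀ * (y + 1ℚ - x) + 2 * P * R * a₁
    in 2 * (P * (Q * R)) * (a₀ * f₀ + a₁ * f₁ + a₂ * f₂)
       - 2 * (P * (Q * R)) * (c * ((x′ + 1ℚ) * (x′ + 1ℚ) * (x′ + 1ℚ)) * f₃ * v - c * ((x + 1ℚ) * (x + 1ℚ) * (x + 1ℚ)) * f₂ * u)
     ≡ 2 * Q * R * a₀ * (P * f₀ - (y + 1ℚ - x) * f₁)
       + c₂ * ((y₁ + x + 1ℚ) * f₁ - (y₁ + 1ℚ - x) * f₂)
       + - (c * P) * (2 * ((x + 2) * (x + 2) * (x + 2)) * f₃ - - ((y₂ + x + 1ℚ) * (y₂ - x) * (2 * x + 1ℚ) * f₂))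
       + 2 * c * R * ((x + 1ℚ) * (x + 1ℚ) * (x + 1ℚ)) * f₂ * (u * ((y + x + 1ℚ) * (y + x + 1ℚ + 1ℚ)) - 1ℚ)
       + - (2 * c * P * ((x + 2) * (x + 2) * (x + 2)) * f₃) * (v * ((y + x′ + 1ℚ) * (y + x′ + 1ℚ + 1ℚ)) - 1ℚ)
       + - (c₂ * (f₁ - f₂)) * (y₁ - (y + 1ℚ))
       + c * P * (2 * x + 1ℚ) * f₂ * (y₂ + y + 3) * (y₂ - (2 + y))
       + (2 * c * P * ((x + 2) * (x + 2) * (x + 2)) * f₃ * v * (y + x′ + 1ℚ + R)
         - 2 * (P * (Q * R)) * c * f₃ * v * ((x′ + 1ℚ) * (x′ + 1ℚ) + (x′ + 1ℚ) * (x + 2) + (x + 2) * (x + 2))) * (x′ - (x + 1ℚ))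
  identity = solve-∀ ℚ-ring

sumUpTo : (ℕ → ℚ) → ℕ → ℚ
sumUpTo f zero    = 0ℚ
sumUpTo f (suc m) = f 0 + sumUpTo (f ∘ suc) m

sumℚ-map-applyUpTo : ∀ (f : ℕ → ℚ) g m → sumℚ (map f (applyUpTo g m)) ≡ sumUpTo (f ∘ g) m
sumℚ-map-applyUpTo f g zero    = refl
sumℚ-map-applyUpTo f g (suc m) = cong (_+_ (f (g 0))) (sumℚ-map-applyUpTo f (g ∘ suc) m)

sumUpTo-suc : ∀ f m → sumUpTo f (suc m) ≡ sumUpTo f m + f m
sumUpTo-suc f zero    = ℚ.+-comm (f 0) 0ℚ
sumUpTo-suc f (suc m) = trans (cong (_+_ (f 0)) (sumUpTo-suc (f ∘ suc) m))
                              (sym (ℚ.+-assoc (f 0) (sumUpTo (f ∘ suc) m) (f (suc m))))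

sumUpTo-cong : ∀ {f g} m → (∀ k → f k ≡ g k) → sumUpTo f m ≡ sumUpTo g m
sumUpTo-cong zero    f≗g = refl
sumUpTo-cong (suc m) f≗g = cong₂ _+_ (f≗g 0) (sumUpTo-cong m (f≗g ∘ suc))

sumUpTo-linear₃ : ∀ (a b c : ℚ) f g h m →
  sumUpTo (λ k → a * f k + b * g k + c * h k) m ≡ a * sumUpTo f m + b * sumUpTo g m + c * sumUpTo h m
sumUpTo-linear₃ a b c f g h zero    = identity a b c
  where
  identity : ∀ a b c → 0ℚ ≡ a * 0ℚ + b * 0ℚ + c * 0ℚ
  identity = solve-∀ ℚ-ring
sumUpTo-linear₃ a b c f g h (suc m) =
  trans (cong (_+_ (a * f 0 + b * g 0 + c * h 0)) (sumUpTo-linear₃ a b c (f ∘ suc) (g ∘ suc) (h ∘ suc) m))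
        (distribute a b c (f 0) (g 0) (h 0) (sumUpTo (f ∘ suc) m) (sumUpTo (g ∘ suc) m) (sumUpTo (h ∘ suc) m))
  where
  distribute : ∀ a b c x y z X Y Z → a * x + b * y + c * z + (a * X + b * Y + c * Z) ≡ a * (x + X) + b * (y + Y) + c * (z + Z)
  distribute = solve-∀ ℚ-ring

sumUpTo-telescope : ∀ (g : ℕ → ℚ) m → sumUpTo (λ k → g (suc k) - g k) m ≡ g m - g 0
sumUpTo-telescope g zero    = sym (ℚ.+-inverseʳ (g 0))
sumUpTo-telescope g (suc m) = trans (cong (_+_ (g 1 - g 0)) (sumUpTo-telescope (g ∘ suc) m)) (cancel (g 0) (g 1) (g (suc m)))
  where
  cancel : ∀ a b c → b - a + (c - b) ≡ c - a
  cancel = solve-∀ ℚ-ring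

summand-vanishes : ∀ n k → n ℕ.< k → summand n k ≡ 0ℚ
summand-vanishes n k n<k = begin
  summand n k                                          ≡⟨ summand-factorised n k ⟩
  [-1/4]^ k * (Cℚ n k * e * d) * 1/[1+ k ]³            ≡⟨ cong (λ c → [-1/4]^ k * (fromℕ c * e * d) * 1/[1+ k ]³) (k>n⇒nCk≡0 n<k) ⟩
  [-1/4]^ k * (0ℚ * e * d) * 1/[1+ k ]³                ≡⟨ vanish ([-1/4]^ k) e d 1/[1+ k ]³ ⟩
  0ℚ                                                   ∎
  where
  open ≡-Reasoning
  e = Cℚ (n ℕ.+ k) k
  d = Cℚ (2 ℕ.* k) k
  vanish : ∀ s e d w → s * (0ℚ * e * d) * w ≡ 0ℚ
  vanish = solve-∀ ℚ-ring

lhs-as-longer-sum : ∀ n d → sumUpTo (summand n) (d ℕ.+ suc n) ≡ lhs n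
lhs-as-longer-sum n zero    = sym (sumℚ-map-applyUpTo (summand n) (λ k → k) (suc n))
lhs-as-longer-sum n (suc d) = begin
  sumUpTo (summand n) (suc (d ℕ.+ suc n))                     ≡⟨ sumUpTo-suc (summand n) (d ℕ.+ suc n) ⟩
  sumUpTo (summand n) (d ℕ.+ suc n) + summand n (d ℕ.+ suc n) ≡⟨ cong₂ _+_ (lhs-as-longer-sum n d)
                                                                    (summand-vanishes n (d ℕ.+ suc n) (ℕ.m≤n+m (suc n) d)) ⟩
  lhs n + 0ℚ                                                  ≡⟨ ℚ.+-identityʳ (lhs n) ⟩
  lhs n                                                       ∎
  where open ≡-Reasoning

Recurrence : ℕ → ℚ → ℚ → ℚ → Set
Recurrence n u v w = let y = fromℕ n in a₀ y * u + a₁ y * v + a₂ y * w ≡ b y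

recurrence-at : ∀ {n y u v w} → fromℕ n ≡ y → a₀ y * u + a₁ y * v + a₂ y * w ≡ b y → Recurrence n u v w
recurrence-at refl r = r

-- Summing Zeilberger's recurrence over 0 ≤ k < n + 3 telescopes to the boundary terms,
-- of which only certificate n 0 survives.
lhs-recurrence : ∀ n → Recurrence n (lhs n) (lhs (suc n)) (lhs (2 ℕ.+ n))
lhs-recurrence n = begin
  a₀ y * lhs n + a₁ y * lhs (suc n) + a₂ y * lhs (2 ℕ.+ n)
    ≡⟨ cong₃ (λ s₀ s₁ s₂ → a₀ y * s₀ + a₁ y * s₁ + a₂ y * s₂)
         (lhs-as-longer-sum n 2) (lhs-as-longer-sum (suc n) 1) (lhs-as-longer-sum (2 ℕ.+ n) 0) ⟨
  a₀ y * sumUpTo (summand n) T + a₁ y * sumUpTo (summand (suc n)) T + a₂ y * sumUpTo (summand (2 ℕ.+ n)) T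
    ≡⟨ sumUpTo-linear₃ (a₀ y) (a₁ y) (a₂ y) (summand n) (summand (suc n)) (summand (2 ℕ.+ n)) T ⟨
  sumUpTo (λ k → a₀ y * summand n k + a₁ y * summand (suc n) k + a₂ y * summand (2 ℕ.+ n) k) T
    ≡⟨ sumUpTo-cong T (summand-recurrence n) ⟩
  sumUpTo (λ k → certificate n (suc k) - certificate n k) T
    ≡⟨ sumUpTo-telescope (certificate n) T ⟩
  certificate n T - certificate n 0
    ≡⟨ linear-combination (boundary y (fromℕ T) (summand (2 ℕ.+ n) T) u₀ u)
         (- (2 * (y + 1ℚ) * (y + 2) * (2 * y + 3)) * ((fromℕ T + 1ℚ) * (fromℕ T + 1ℚ) * (fromℕ T + 1ℚ)) * u
            · summand-vanishes (2 ℕ.+ n) T (ℕ.n<1+n (2 ℕ.+ n))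
          ⊕ b y · certificate-denominator n 0) ⟩
  b y ∎
  where
  open ≡-Reasoning
  y = fromℕ n
  T = 3 ℕ.+ n
  u₀ = 1/ℕ (suc (n ℕ.+ 0) ℕ.* suc (suc (n ℕ.+ 0)))
  u = 1/ℕ (suc (n ℕ.+ T) ℕ.* suc (suc (n ℕ.+ T)))
  cong₃ : ∀ (f : ℚ → ℚ → ℚ → ℚ) {a b c a′ b′ c′} → a ≡ a′ → b ≡ b′ → c ≡ c′ → f a b c ≡ f a′ b′ c′
  cong₃ f refl refl refl = refl
  boundary : ∀ y t f u₀ u →
    - (2 * (y + 1ℚ) * (y + 2) * (2 * y + 3)) * ((t + 1ℚ) * (t + 1ℚ) * (t + 1ℚ)) * f * u
    - - (2 * (y + 1ℚ) * (y + 2) * (2 * y + 3)) * ((0ℚ + 1ℚ) * (0ℚ + 1ℚ) * (0ℚ + 1ℚ)) * 1ℚ * u₀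
    - 2 * (2 * y + 3)
    ≡ - (2 * (y + 1ℚ) * (y + 2) * (2 * y + 3)) * ((t + 1ℚ) * (t + 1ℚ) * (t + 1ℚ)) * u * (f - 0ℚ)
      + 2 * (2 * y + 3) * (u₀ * ((y + 0ℚ + 1ℚ) * (y + 0ℚ + 1ℚ + 1ℚ)) - 1ℚ)
  boundary = solve-∀ ℚ-ring

fromℕ-[1+n][3+n]³ : ∀ n → fromℕ (suc n ℕ.* suc (suc (suc n)) ℕ.^ 3) ≡ a₂ (fromℕ n)
fromℕ-[1+n][3+n]³ n = trans (fromℕ-* (suc n) (suc (suc (suc n)) ℕ.^ 3))
  (trans (cong₂ _*_ (fromℕ-suc n) (trans (fromℕ-[1+n]³ (suc (suc n))) (cong (λ z → (z + 1ℚ) * (z + 1ℚ) * (z + 1ℚ)) (fromℕ-+ 2 n))))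
         (reassociate (fromℕ n)))
  where
  reassociate : ∀ y → (y + 1ℚ) * ((2 + y + 1ℚ) * (2 + y + 1ℚ) * (2 + y + 1ℚ)) ≡ (y + 1ℚ) * ((y + 3) * (y + 3) * (y + 3))
  reassociate = solve-∀ ℚ-ring

recurrence-determines-last : ∀ {n u v w w′} → Recurrence n u v w → Recurrence n u v w′ → w ≡ w′
recurrence-determines-last {n} {u} {v} {w} {w′} r r′ = *-cancelˡ-fromℕ (suc n ℕ.* suc (suc (suc n)) ℕ.^ 3)
  (fromℕ-[1+n][3+n]³ n) (linear-combination (difference (a₀ y) (a₁ y) (a₂ y) (b y) u v w w′) (1ℚ · r ⊕ - 1ℚ · r′))
  where
  y = fromℕ n
  difference : ∀ a₀ a₁ a₂ b u v w w′ → a₂ * w - a₂ * w′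
    ≡ 1ℚ * (a₀ * u + a₁ * v + a₂ * w - b) + - 1ℚ * (a₀ * u + a₁ * v + a₂ * w′ - b)
  difference = solve-∀ ℚ-ring

oddNumerator : ℕ → ℤ
oddNumerator n = + 4 ℤ.* (+ n) ℤ.^ 4 ℤ.+ + 8 ℤ.* (+ n) ℤ.^ 3 ℤ.+ + 3 ℤ.* (+ n) ℤ.^ 2 ℤ.- + n ℤ.+ + 1

caseFactor-odd : ∀ n → n ℕ.% 2 ≡ 1 → .{{n≢0 : NonZero n}} →
  caseFactor n ≡ ℚ._/_ (oddNumerator n) (n ℕ.* suc n ℕ.^ 3) {{ℕ.m*n≢0 n (suc n ℕ.^ 3) {{n≢0}} {{ℕ.m^n≢0 (suc n) 3}}}}
caseFactor-odd n n%2≡1 with n ℕ.% 2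
caseFactor-odd n refl | .1 = refl

caseFactor-even : ∀ n → n ℕ.% 2 ≡ 0 → .{{_ : NonZero n}} →
  caseFactor n ≡ ℚ._/_ (+ ((2 ℕ.* n ℕ.+ 1) ℕ.^ 2)) (n ℕ.* suc n) {{ℕ.m*n≢0 n (suc n)}}
caseFactor-even n n%2≡0 with n ℕ.% 2
caseFactor-even n refl | .0 = refl

centralTerm : ℕ → ℚ
centralTerm m = ℚ._/_ (+ (((2 ℕ.* m) C m) ℕ.^ 2)) (16 ℕ.^ m) {{ℕ.m^n≢0 16 m}}

pow : ℚ → ℕ → ℚ
pow y zero    = 1ℚ
pow y (suc k) = y * pow y k

fromℤ-^ : ∀ i k → fromℤ (i ℤ.^ k) ≡ pow (fromℤ i) k
fromℤ-^ i zero    = refl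
fromℤ-^ i (suc k) = trans (fromℤ-* i (i ℤ.^ k)) (cong (fromℤ i *_) (fromℤ-^ i k))

fromℤ-oddNumerator : ∀ n → fromℤ (oddNumerator n)
  ≡ 4 * pow (fromℕ n) 4 + 8 * pow (fromℕ n) 3 + 3 * pow (fromℕ n) 2 + - fromℕ n + 1ℚ
fromℤ-oddNumerator n = begin
  fromℤ (c 4 4 ℤ.+ c 8 3 ℤ.+ c 3 2 ℤ.- + n ℤ.+ + 1)                        ≡⟨ fromℤ-+ (c 4 4 ℤ.+ c 8 3 ℤ.+ c 3 2 ℤ.- + n) (+ 1) ⟩
  fromℤ (c 4 4 ℤ.+ c 8 3 ℤ.+ c 3 2 ℤ.- + n) + 1ℚ                           ≡⟨ cong (_+ 1ℚ) (fromℤ-+ (c 4 4 ℤ.+ c 8 3 ℤ.+ c 3 2) (ℤ.- + n)) ⟩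
  fromℤ (c 4 4 ℤ.+ c 8 3 ℤ.+ c 3 2) + fromℤ (ℤ.- + n) + 1ℚ                 ≡⟨ cong₂ (λ a b → a + b + 1ℚ) (fromℤ-+ (c 4 4 ℤ.+ c 8 3) (c 3 2)) (fromℤ-neg (+ n)) ⟩
  fromℤ (c 4 4 ℤ.+ c 8 3) + fromℤ (c 3 2) + - fromℕ n + 1ℚ                ≡⟨ cong (λ a → a + fromℤ (c 3 2) + - fromℕ n + 1ℚ) (fromℤ-+ (c 4 4) (c 8 3)) ⟩
  fromℤ (c 4 4) + fromℤ (c 8 3) + fromℤ (c 3 2) + - fromℕ n + 1ℚ          ≡⟨ cong₂ (λ a b → a + b + fromℤ (c 3 2) + - fromℕ n + 1ℚ) (monomial 4 4) (monomial 8 3) ⟩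
  4 * pow (fromℕ n) 4 + 8 * pow (fromℕ n) 3 + fromℤ (c 3 2) + - fromℕ n + 1ℚ ≡⟨ cong (λ a → 4 * pow (fromℕ n) 4 + 8 * pow (fromℕ n) 3 + a + - fromℕ n + 1ℚ) (monomial 3 2) ⟩
  4 * pow (fromℕ n) 4 + 8 * pow (fromℕ n) 3 + 3 * pow (fromℕ n) 2 + - fromℕ n + 1ℚ ∎
  where
  open ≡-Reasoning
  c : ℕ → ℕ → ℤ
  c a k = + a ℤ.* (+ n) ℤ.^ k
  monomial : ∀ a k → fromℤ (c a k) ≡ fromℕ a * pow (fromℕ n) k
  monomial a k = trans (fromℤ-* (+ a) ((+ n) ℤ.^ k)) (cong (fromℕ a *_) (fromℤ-^ (+ n) k))

OddClosedForm : ℚ → ℚ → ℚ → Set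
OddClosedForm y X t = y * ((y + 1ℚ) * (y + 1ℚ) * (y + 1ℚ)) * t
  ≡ - (2 * ((y + 1ℚ) * (y + 1ℚ))) + X * (4 * (y * y * y * y) + 8 * (y * y * y) + 3 * (y * y) - y + 1ℚ)

EvenClosedForm : ℚ → ℚ → ℚ → Set
EvenClosedForm y X t = y * (y + 1ℚ) * t ≡ - 2 + X * ((2 * y + 1ℚ) * (2 * y + 1ℚ))

rhs-odd-closed : ∀ n j → n ℕ.% 2 ≡ 1 → n ℕ./ 2 ≡ j → .{{_ : NonZero n}} → OddClosedForm (fromℕ n) (centralTerm j) (rhs n)
rhs-odd-closed n j n%2≡1 n/2≡j {{n≢0}} = linear-combination (identity y X p i₂ i₄ (rhs n))
  (y * ((y + 1ℚ) * (y + 1ℚ) * (y + 1ℚ)) · rhs≡ ⊕ X · fromℤ-oddNumerator n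
     ⊕ fromℤ (ℤ.- + 2) * ((y + 1ℚ) * (y + 1ℚ)) · 1/ℕ-inverse (n ℕ.* suc n) {{n[1+n]≢0}} fromℕ-n[1+n]
     ⊕ X * p · 1/ℕ-inverse (n ℕ.* suc n ℕ.^ 3) {{n[1+n]³≢0}} fromℕ-n[1+n]³)
  where
  y = fromℕ n
  X = centralTerm j
  p = fromℤ (oddNumerator n)
  n[1+n]≢0 = ℕ.m*n≢0 n (suc n) {{n≢0}}
  n[1+n]³≢0 = ℕ.m*n≢0 n (suc n ℕ.^ 3) {{n≢0}} {{ℕ.m^n≢0 (suc n) 3}}
  i₂ = 1/ℕ (n ℕ.* suc n) {{n[1+n]≢0}}
  i₄ = 1/ℕ (n ℕ.* suc n ℕ.^ 3) {{n[1+n]³≢0}}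
  fromℕ-n[1+n] : fromℕ (n ℕ.* suc n) ≡ y * (y + 1ℚ)
  fromℕ-n[1+n] = trans (fromℕ-* n (suc n)) (cong (y *_) (fromℕ-suc n))
  fromℕ-n[1+n]³ : fromℕ (n ℕ.* suc n ℕ.^ 3) ≡ y * ((y + 1ℚ) * (y + 1ℚ) * (y + 1ℚ))
  fromℕ-n[1+n]³ = trans (fromℕ-* n (suc n ℕ.^ 3)) (cong (y *_) (fromℕ-[1+n]³ n))
  rhs≡ : rhs n ≡ fromℤ (ℤ.- + 2) * i₂ + X * (p * i₄)
  rhs≡ = cong₂ _+_ (i/n≡i*1/n (ℤ.- + 2) (n ℕ.* suc n) {{n[1+n]≢0}})
    (cong₂ _*_ (cong centralTerm n/2≡j) (trans (caseFactor-odd n n%2≡1 {{n≢0}}) (i/n≡i*1/n (oddNumerator n) (n ℕ.* suc n ℕ.^ 3) {{n[1+n]³≢0}})))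
  identity : ∀ y X p i₂ i₄ t →
    y * ((y + 1ℚ) * (y + 1ℚ) * (y + 1ℚ)) * t - (- (2 * ((y + 1ℚ) * (y + 1ℚ))) + X * (4 * (y * y * y * y) + 8 * (y * y * y) + 3 * (y * y) - y + 1ℚ))
    ≡ y * ((y + 1ℚ) * (y + 1ℚ) * (y + 1ℚ)) * (t - (fromℤ (ℤ.- + 2) * i₂ + X * (p * i₄)))
      + X * (p - (4 * (y * (y * (y * (y * 1ℚ)))) + 8 * (y * (y * (y * 1ℚ))) + 3 * (y * (y * 1ℚ)) + - y + 1ℚ))
      + fromℤ (ℤ.- + 2) * ((y + 1ℚ) * (y + 1ℚ)) * (i₂ * (y * (y + 1ℚ)) - 1ℚ)
      + X * p * (i₄ * (y * ((y + 1ℚ) * (y + 1ℚ) * (y + 1ℚ))) - 1ℚ)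
  identity = solve-∀ ℚ-ring

rhs-even-closed : ∀ n j → n ℕ.% 2 ≡ 0 → n ℕ./ 2 ≡ j → .{{_ : NonZero n}} → EvenClosedForm (fromℕ n) (centralTerm j) (rhs n)
rhs-even-closed n j n%2≡0 n/2≡j {{n≢0}} = linear-combination (identity y X e i₂ (rhs n))
  (y * (y + 1ℚ) · rhs≡ ⊕ X · fromℕ-[2n+1]² ⊕ fromℤ (ℤ.- + 2) + X * e · 1/ℕ-inverse (n ℕ.* suc n) {{n[1+n]≢0}} fromℕ-n[1+n])
  where
  y = fromℕ n
  X = centralTerm j
  e = fromℕ ((2 ℕ.* n ℕ.+ 1) ℕ.^ 2)
  n[1+n]≢0 = ℕ.m*n≢0 n (suc n) {{n≢0}}
  i₂ = 1/ℕ (n ℕ.* suc n) {{n[1+n]≢0}}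
  fromℕ-n[1+n] : fromℕ (n ℕ.* suc n) ≡ y * (y + 1ℚ)
  fromℕ-n[1+n] = trans (fromℕ-* n (suc n)) (cong (y *_) (fromℕ-suc n))
  fromℕ-[2n+1]² : e ≡ (2 * y + 1ℚ) * (2 * y + 1ℚ)
  fromℕ-[2n+1]² = trans (fromℕ-² (2 ℕ.* n ℕ.+ 1)) (cong (λ z → z * z) (trans (fromℕ-+ (2 ℕ.* n) 1) (cong (_+ 1ℚ) (fromℕ-* 2 n))))
  rhs≡ : rhs n ≡ fromℤ (ℤ.- + 2) * i₂ + X * (e * i₂)
  rhs≡ = cong₂ _+_ (i/n≡i*1/n (ℤ.- + 2) (n ℕ.* suc n) {{n[1+n]≢0}})
    (cong₂ _*_ (cong centralTerm n/2≡j) (trans (caseFactor-even n n%2≡0 {{n≢0}}) (i/n≡i*1/n (+ ((2 ℕ.* n ℕ.+ 1) ℕ.^ 2)) (n ℕ.* suc n) {{n[1+n]≢0}})))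
  identity : ∀ y X e i₂ t →
    y * (y + 1ℚ) * t - (- 2 + X * ((2 * y + 1ℚ) * (2 * y + 1ℚ)))
    ≡ y * (y + 1ℚ) * (t - (fromℤ (ℤ.- + 2) * i₂ + X * (e * i₂)))
      + X * (e - (2 * y + 1ℚ) * (2 * y + 1ℚ))
      + (fromℤ (ℤ.- + 2) + X * e) * (i₂ * (y * (y + 1ℚ)) - 1ℚ)
  identity = solve-∀ ℚ-ring

odd-%2 : ∀ m → suc (2 ℕ.* m) ℕ.% 2 ≡ 1
odd-%2 m = trans (cong (λ t → suc t ℕ.% 2) (ℕ.*-comm 2 m)) (DivMod.[m+kn]%n≡m%n 1 m 2)

odd-/2 : ∀ m → suc (2 ℕ.* m) ℕ./ 2 ≡ m
odd-/2 m = trans (cong (λ t → suc t ℕ./ 2) (ℕ.*-comm 2 m)) (trans (DivMod.+-distrib-/-∣ʳ 1 {d = 2} (n∣m*n m)) (DivMod.m*n/n≡m m 2))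

even-%2 : ∀ m → suc (suc (2 ℕ.* m)) ℕ.% 2 ≡ 0
even-%2 m = trans (cong (ℕ._% 2) (ℕ.*-comm 2 m)) (DivMod.m*n%n≡0 m 2)

even-/2 : ∀ m → suc (suc (2 ℕ.* m)) ℕ./ 2 ≡ suc m
even-/2 m = trans (cong (λ t → suc (suc t) ℕ./ 2) (ℕ.*-comm 2 m)) (DivMod.m*n/n≡m (suc m) 2)

fromℕ-odd : ∀ m → fromℕ (suc (2 ℕ.* m)) ≡ 2 * fromℕ m + 1ℚ
fromℕ-odd m = trans (fromℕ-suc (2 ℕ.* m)) (cong (_+ 1ℚ) (fromℕ-* 2 m))

fromℕ-even : ∀ m → fromℕ (suc (suc (2 ℕ.* m))) ≡ 2 * fromℕ m + 2
fromℕ-even m = trans (cong fromℕ (ℕ.+-comm 2 (2 ℕ.* m))) (trans (fromℕ-+ (2 ℕ.* m) 2) (cong (_+ 2) (fromℕ-* 2 m)))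

rhs-odd : ∀ n m {x} → n ≡ suc (2 ℕ.* m) → fromℕ m ≡ x → .{{_ : NonZero n}} → OddClosedForm (2 * x + 1ℚ) (centralTerm m) (rhs n)
rhs-odd _ m refl refl = subst (λ y → OddClosedForm y (centralTerm m) (rhs (suc (2 ℕ.* m)))) (fromℕ-odd m)
  (rhs-odd-closed (suc (2 ℕ.* m)) m (odd-%2 m) (odd-/2 m))

rhs-even : ∀ n m {x} → n ≡ suc (suc (2 ℕ.* m)) → fromℕ m ≡ x → .{{_ : NonZero n}} → EvenClosedForm (2 * x + 2) (centralTerm (suc m)) (rhs n)
rhs-even _ m refl refl = subst (λ y → EvenClosedForm y (centralTerm (suc m)) (rhs (suc (suc (2 ℕ.* m))))) (fromℕ-even m)
  (rhs-even-closed (suc (suc (2 ℕ.* m))) (suc m) (even-%2 m) (even-/2 m))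

centralTerm-ratio : ∀ m {x} → fromℕ m ≡ x → centralTerm (suc m) * (4 * ((x + 1ℚ) * (x + 1ℚ))) ≡ centralTerm m * ((2 * x + 1ℚ) * (2 * x + 1ℚ))
centralTerm-ratio m refl = linear-combination (identity x (centralTerm (suc m)) (centralTerm m) c d i)
  (4 * ((x + 1ℚ) * (x + 1ℚ)) · centralTerm-suc ⊕ - ((2 * x + 1ℚ) * (2 * x + 1ℚ)) · centralTerm≡
     ⊕ 4 * 1/ℕ 16 * i * ((x + 1ℚ) * c + 2 * (2 * x + 1ℚ) * d) · Cℚ-central-step m)
  where
  x = fromℕ m
  c = Cℚ (2 ℕ.+ 2 ℕ.* m) (suc m)
  d = Cℚ (2 ℕ.* m) m
  i = 1/ℕ (16 ℕ.^ m) {{ℕ.m^n≢0 16 m}}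
  centralTerm≡ : centralTerm m ≡ d * d * i
  centralTerm≡ = trans (i/n≡i*1/n (+ (((2 ℕ.* m) C m) ℕ.^ 2)) (16 ℕ.^ m) {{ℕ.m^n≢0 16 m}}) (cong (_* i) (fromℕ-² ((2 ℕ.* m) C m)))
  centralTerm-suc : centralTerm (suc m) ≡ c * c * (1/ℕ 16 * i)
  centralTerm-suc = trans (i/n≡i*1/n (+ (((2 ℕ.* suc m) C suc m) ℕ.^ 2)) (16 ℕ.^ suc m) {{ℕ.m^n≢0 16 (suc m)}})
    (cong₂ _*_ (trans (fromℕ-² ((2 ℕ.* suc m) C suc m)) (cong (λ t → Cℚ t (suc m) * Cℚ t (suc m)) (ℕ.*-suc 2 m)))
               (1/ℕ-* 16 (16 ℕ.^ m) {{_}} {{ℕ.m^n≢0 16 m}}))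
  identity : ∀ x X₁ X₀ c d i →
    X₁ * (4 * ((x + 1ℚ) * (x + 1ℚ))) - X₀ * ((2 * x + 1ℚ) * (2 * x + 1ℚ))
    ≡ 4 * ((x + 1ℚ) * (x + 1ℚ)) * (X₁ - c * c * (1/ℕ 16 * i)) + - ((2 * x + 1ℚ) * (2 * x + 1ℚ)) * (X₀ - d * d * i)
      + 4 * 1/ℕ 16 * i * ((x + 1ℚ) * c + 2 * (2 * x + 1ℚ) * d) * ((x + 1ℚ) * c - 2 * (2 * x + 1ℚ) * d)
  identity = solve-∀ ℚ-ring

fromℕ-[1+n]³[2+n][3+n]³ : ∀ n → let y = fromℕ n in fromℕ (suc n ℕ.^ 3 ℕ.* (suc (suc n) ℕ.* suc (suc (suc n)) ℕ.^ 3))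
  ≡ (y + 1ℚ) * (y + 1ℚ) * (y + 1ℚ) * ((y + 2) * ((y + 3) * (y + 3) * (y + 3)))
fromℕ-[1+n]³[2+n][3+n]³ n = begin
  fromℕ (suc n ℕ.^ 3 ℕ.* (suc (suc n) ℕ.* suc (suc (suc n)) ℕ.^ 3))
    ≡⟨ fromℕ-* (suc n ℕ.^ 3) (suc (suc n) ℕ.* suc (suc (suc n)) ℕ.^ 3) ⟩
  fromℕ (suc n ℕ.^ 3) * fromℕ (suc (suc n) ℕ.* suc (suc (suc n)) ℕ.^ 3)
    ≡⟨ cong (fromℕ (suc n ℕ.^ 3) *_) (fromℕ-* (suc (suc n)) (suc (suc (suc n)) ℕ.^ 3)) ⟩
  fromℕ (suc n ℕ.^ 3) * (fromℕ (suc (suc n)) * fromℕ (suc (suc (suc n)) ℕ.^ 3))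
    ≡⟨ cong₂ (λ a b → a * (fromℕ (suc (suc n)) * b)) (fromℕ-[1+n]³ n) (fromℕ-[1+n]³ (suc (suc n))) ⟩
  cube (y + 1ℚ) * (fromℕ (2 ℕ.+ n) * cube (fromℕ (2 ℕ.+ n) + 1ℚ))
    ≡⟨ cong (λ a → cube (y + 1ℚ) * (a * cube (a + 1ℚ))) (fromℕ-+ 2 n) ⟩
  cube (y + 1ℚ) * ((2 + y) * cube (2 + y + 1ℚ))
    ≡⟨ normalise y ⟩
  (y + 1ℚ) * (y + 1ℚ) * (y + 1ℚ) * ((y + 2) * ((y + 3) * (y + 3) * (y + 3))) ∎
  where
  open ≡-Reasoning
  y = fromℕ n
  cube : ℚ → ℚ
  cube z = z * z * z
  normalise : ∀ y → (y + 1ℚ) * (y + 1ℚ) * (y + 1ℚ) * ((2 + y) * ((2 + y + 1ℚ) * (2 + y + 1ℚ) * (2 + y + 1ℚ)))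
    ≡ (y + 1ℚ) * (y + 1ℚ) * (y + 1ℚ) * ((y + 2) * ((y + 3) * (y + 3) * (y + 3)))
  normalise = solve-∀ ℚ-ring

fromℕ-[1+n][2+n]³[3+n] : ∀ n → let y = fromℕ n in fromℕ (suc n ℕ.* (suc (suc n) ℕ.^ 3 ℕ.* suc (suc (suc n))))
  ≡ (y + 1ℚ) * ((y + 2) * (y + 2) * (y + 2) * (y + 3))
fromℕ-[1+n][2+n]³[3+n] n = begin
  fromℕ (suc n ℕ.* (suc (suc n) ℕ.^ 3 ℕ.* suc (suc (suc n))))
    ≡⟨ fromℕ-* (suc n) (suc (suc n) ℕ.^ 3 ℕ.* suc (suc (suc n))) ⟩
  fromℕ (suc n) * fromℕ (suc (suc n) ℕ.^ 3 ℕ.* suc (suc (suc n)))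
    ≡⟨ cong (fromℕ (suc n) *_) (fromℕ-* (suc (suc n) ℕ.^ 3) (suc (suc (suc n)))) ⟩
  fromℕ (suc n) * (fromℕ (suc (suc n) ℕ.^ 3) * fromℕ (3 ℕ.+ n))
    ≡⟨ cong (λ a → fromℕ (suc n) * (a * fromℕ (3 ℕ.+ n))) (fromℕ-[1+n]³ (suc n)) ⟩
  fromℕ (suc n) * (cube (fromℕ (suc n) + 1ℚ) * fromℕ (3 ℕ.+ n))
    ≡⟨ cong₂ (λ a b → a * (cube (a + 1ℚ) * b)) (fromℕ-suc n) (fromℕ-+ 3 n) ⟩
  (y + 1ℚ) * (cube (y + 1ℚ + 1ℚ) * (3 + y))
    ≡⟨ normalise y ⟩
  (y + 1ℚ) * ((y + 2) * (y + 2) * (y + 2) * (y + 3)) ∎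
  where
  open ≡-Reasoning
  y = fromℕ n
  cube : ℚ → ℚ
  cube z = z * z * z
  normalise : ∀ y → (y + 1ℚ) * ((y + 1ℚ + 1ℚ) * (y + 1ℚ + 1ℚ) * (y + 1ℚ + 1ℚ) * (3 + y))
    ≡ (y + 1ℚ) * ((y + 2) * (y + 2) * (y + 2) * (y + 3))
  normalise = solve-∀ ℚ-ring

-- Clearing the denominators of the three closed forms turns the recurrence into a polynomial
-- identity modulo those closed forms and the ratio of the two central factors involved.
rhs-recurrence-odd : ∀ m → let n = suc (2 ℕ.* m) in Recurrence n (rhs n) (rhs (suc n)) (rhs (2 ℕ.+ n))
rhs-recurrence-odd m = recurrence-at {n} (fromℕ-odd m) (*-cancelˡ-fromℕ (suc n ℕ.^ 3 ℕ.* (suc (suc n) ℕ.* suc (suc (suc n)) ℕ.^ 3))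
  (trans (fromℕ-[1+n]³[2+n][3+n]³ n) (cong multiplier (fromℕ-odd m)))
  (linear-combination (identity x (rhs n) (rhs (suc n)) (rhs (2 ℕ.+ n)) (centralTerm m) (centralTerm (suc m)))
    (- (y * y * (y + 2) * (y + 2) * ((y + 3) * (y + 3) * (y + 3))) · rhs-odd n m refl refl
     ⊕ a₁ y * ((y + 1ℚ) * (y + 1ℚ)) * ((y + 3) * (y + 3) * (y + 3)) · rhs-even (suc n) m refl refl
     ⊕ (y + 1ℚ) * (y + 1ℚ) * (y + 1ℚ) * (y + 1ℚ) * ((y + 3) * (y + 3) * (y + 3))
         · rhs-odd (2 ℕ.+ n) (suc m) (cong suc (sym (ℕ.*-suc 2 m))) (fromℕ-suc m)
     ⊕ (y + 2) * (y + 2) * ((y + 3) * (y + 3) * (y + 3)) * (4 * (y * y * y * y) + 8 * (y * y * y) + 3 * (y * y) - y + 1ℚ)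
         · centralTerm-ratio m refl)))
  where
  n = suc (2 ℕ.* m)
  x = fromℕ m
  y = 2 * x + 1ℚ
  multiplier : ℚ → ℚ
  multiplier y = (y + 1ℚ) * (y + 1ℚ) * (y + 1ℚ) * ((y + 2) * ((y + 3) * (y + 3) * (y + 3)))
  identity : ∀ x t₀ t₁ t₂ X₀ X₁ →
    let y = 2 * x + 1ℚ
        y₁ = 2 * x + 2
        y₂ = 2 * (x + 1ℚ) + 1ℚ
        M = (y + 1ℚ) * (y + 1ℚ) * (y + 1ℚ) * ((y + 2) * ((y + 3) * (y + 3) * (y + 3)))
        a₁ = - ((2 * y + 3) * (3 * y * y + 9 * y + 5))
        p = 4 * (y * y * y * y) + 8 * (y * y * y) + 3 * (y * y) - y + 1ℚ
        p₂ = 4 * (y₂ * y₂ * y₂ * y₂) + 8 * (y₂ * y₂ * y₂) + 3 * (y₂ * y₂) - y₂ + 1ℚ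
    in M * (- (y * y * y * (y + 2)) * t₀ + a₁ * t₁ + (y + 1ℚ) * ((y + 3) * (y + 3) * (y + 3)) * t₂) - M * (2 * (2 * y + 3))
       ≡ - (y * y * (y + 2) * (y + 2) * ((y + 3) * (y + 3) * (y + 3)))
           * (y * ((y + 1ℚ) * (y + 1ℚ) * (y + 1ℚ)) * t₀ - (- (2 * ((y + 1ℚ) * (y + 1ℚ))) + X₀ * p))
         + a₁ * ((y + 1ℚ) * (y + 1ℚ)) * ((y + 3) * (y + 3) * (y + 3))
           * (y₁ * (y₁ + 1ℚ) * t₁ - (- 2 + X₁ * ((2 * y₁ + 1ℚ) * (2 * y₁ + 1ℚ))))
         + (y + 1ℚ) * (y + 1ℚ) * (y + 1ℚ) * (y + 1ℚ) * ((y + 3) * (y + 3) * (y + 3))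
           * (y₂ * ((y₂ + 1ℚ) * (y₂ + 1ℚ) * (y₂ + 1ℚ)) * t₂ - (- (2 * ((y₂ + 1ℚ) * (y₂ + 1ℚ))) + X₁ * p₂))
         + (y + 2) * (y + 2) * ((y + 3) * (y + 3) * (y + 3)) * p
           * (X₁ * (4 * ((x + 1ℚ) * (x + 1ℚ))) - X₀ * ((2 * x + 1ℚ) * (2 * x + 1ℚ)))
  identity = solve-∀ ℚ-ring

rhs-recurrence-even : ∀ m → let n = suc (suc (2 ℕ.* m)) in Recurrence n (rhs n) (rhs (suc n)) (rhs (2 ℕ.+ n))
rhs-recurrence-even m = recurrence-at {n} (fromℕ-even m) (*-cancelˡ-fromℕ (suc n ℕ.* (suc (suc n) ℕ.^ 3 ℕ.* suc (suc (suc n))))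
  (trans (fromℕ-[1+n][2+n]³[3+n] n) (cong multiplier (fromℕ-even m)))
  (linear-combination (identity x (rhs n) (rhs (suc n)) (rhs (2 ℕ.+ n)) (centralTerm (suc m)) (centralTerm (2 ℕ.+ m)))
    (- (y * y * ((y + 2) * (y + 2) * (y + 2) * (y + 2)) * (y + 3))
         · rhs-even n m refl refl
     ⊕ a₁ y * (y + 3)
         · rhs-odd (suc n) (suc m) (cong suc (sym (ℕ.*-suc 2 m))) (fromℕ-suc m)
     ⊕ (y + 1ℚ) * (y + 1ℚ) * ((y + 2) * (y + 2)) * ((y + 3) * (y + 3) * (y + 3))
         · rhs-even (2 ℕ.+ n) (suc m) (cong (suc ∘ suc) (sym (ℕ.*-suc 2 m))) (fromℕ-suc m)
     ⊕ (y + 1ℚ) * (y + 1ℚ) * ((y + 3) * (y + 3) * (y + 3)) * ((2 * y + 5) * (2 * y + 5))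
         · centralTerm-ratio (suc m) (fromℕ-suc m))))
  where
  n = suc (suc (2 ℕ.* m))
  x = fromℕ m
  y = 2 * x + 2
  multiplier : ℚ → ℚ
  multiplier y = (y + 1ℚ) * ((y + 2) * (y + 2) * (y + 2) * (y + 3))
  identity : ∀ x t₀ t₁ t₂ X₁ X₂ →
    let y = 2 * x + 2
        y₁ = 2 * (x + 1ℚ) + 1ℚ
        y₂ = 2 * (x + 1ℚ) + 2
        M = (y + 1ℚ) * ((y + 2) * (y + 2) * (y + 2) * (y + 3))
        a₁ = - ((2 * y + 3) * (3 * y * y + 9 * y + 5))
        p₁ = 4 * (y₁ * y₁ * y₁ * y₁) + 8 * (y₁ * y₁ * y₁) + 3 * (y₁ * y₁) - y₁ + 1ℚ
    in M * (- (y * y * y * (y + 2)) * t₀ + a₁ * t₁ + (y + 1ℚ) * ((y + 3) * (y + 3) * (y + 3)) * t₂) - M * (2 * (2 * y + 3))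
       ≡ - (y * y * ((y + 2) * (y + 2) * (y + 2) * (y + 2)) * (y + 3))
           * (y * (y + 1ℚ) * t₀ - (- 2 + X₁ * ((2 * y + 1ℚ) * (2 * y + 1ℚ))))
         + a₁ * (y + 3)
           * (y₁ * ((y₁ + 1ℚ) * (y₁ + 1ℚ) * (y₁ + 1ℚ)) * t₁ - (- (2 * ((y₁ + 1ℚ) * (y₁ + 1ℚ))) + X₁ * p₁))
         + (y + 1ℚ) * (y + 1ℚ) * ((y + 2) * (y + 2)) * ((y + 3) * (y + 3) * (y + 3))
           * (y₂ * (y₂ + 1ℚ) * t₂ - (- 2 + X₂ * ((2 * y₂ + 1ℚ) * (2 * y₂ + 1ℚ))))
         + (y + 1ℚ) * (y + 1ℚ) * ((y + 3) * (y + 3) * (y + 3)) * ((2 * y + 5) * (2 * y + 5))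
           * (X₂ * (4 * ((x + 1ℚ + 1ℚ) * (x + 1ℚ + 1ℚ))) - X₁ * ((2 * (x + 1ℚ) + 1ℚ) * (2 * (x + 1ℚ) + 1ℚ)))
  identity = solve-∀ ℚ-ring

even-or-odd : ∀ t → ∃[ m ] (t ≡ 2 ℕ.* m ⊎ t ≡ suc (2 ℕ.* m))
even-or-odd zero = 0 , inj₁ refl
even-or-odd (suc t) with even-or-odd t
... | m , inj₁ t≡2m   = m , inj₂ (cong suc t≡2m)
... | m , inj₂ t≡1+2m = suc m , inj₁ (trans (cong suc t≡1+2m) (sym (ℕ.*-suc 2 m)))

rhs-recurrence : ∀ t → Recurrence (suc t) (rhs (suc t)) (rhs (2 ℕ.+ t)) (rhs (3 ℕ.+ t))
rhs-recurrence t = by-parity t (even-or-odd t)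
  where
  by-parity : ∀ t → ∃[ m ] (t ≡ 2 ℕ.* m ⊎ t ≡ suc (2 ℕ.* m)) → Recurrence (suc t) (rhs (suc t)) (rhs (2 ℕ.+ t)) (rhs (3 ℕ.+ t))
  by-parity _ (m , inj₁ refl) = rhs-recurrence-odd m
  by-parity _ (m , inj₂ refl) = rhs-recurrence-even m

lhs≡rhs-consecutive : ∀ t → lhs (suc t) ≡ rhs (suc t) × lhs (2 ℕ.+ t) ≡ rhs (2 ℕ.+ t)
lhs≡rhs-consecutive zero    = refl , refl
lhs≡rhs-consecutive (suc t) = e₂ , recurrence-determines-last {suc t}
  (subst₂ (λ u v → Recurrence (suc t) u v (lhs (3 ℕ.+ t))) e₁ e₂ (lhs-recurrence (suc t))) (rhs-recurrence t)
  where
  e₁ = proj₁ (lhs≡rhs-consecutive t)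
  e₂ = proj₂ (lhs≡rhs-consecutive t)

mainTheorem4 : (n : ℕ) → .{{_ : NonZero n}} → lhs n ≡ rhs n
mainTheorem4 (suc t) = proj₁ (lhs≡rhs-consecutive t)
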